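{- Let $\lambda=[\lambda_1,\ldots,\lambda_k]$ be a partition with frequency representation $[a_1,\ldots,a_{\lambda_1}]$, let $n$ be a positive integer, and let $v=(v_1<\cdots<v_k)$ be a strictly increasing vector of length $k$ with entries in $\{1,\ldots,n\}$. Then $P(v,\lambda,n)$ consists exactly of all real $\lambda_1\times n$ matrices $X=(X_{ij})$ such that (i) $0\le\sum_{i'=1}^{i}X_{i'j}\le 1$ for all $1\le i\le\lambda_1$, $1\le j\le n$; (ii) $0\le\sum_{j'=1}^{j}X_{ij'}$ for all $1\le i\le\lambda_1$, $1\le j\le n$; (iii) $\sum_{j'=1}^{n}X_{ij'}=a_{\lambda_1-i+1}$ for all $1\le i\le\lambda_1$; (iv) $\sum_{i'=1}^{\lambda_1}X_{i'j}=1$ if $j$ is an entry of $v$, and $=0$ otherwise, for $1\le j\le n$.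
   Context: A partition $\lambda=[\lambda_1,\ldots,\lambda_k]$ is a weakly decreasing sequence of positive integers; $k$ is its length; $a_i$ is the number of parts equal to $i$. A sign matrix is a matrix with entries in $\{ -1,0,1\}$ all of whose column partial sums from the top lie in $\{0,1\}$ and all of whose row partial sums from the left are nonnegative. $M(\lambda,n)$ is the set of $\lambda_1\times n$ sign matrices whose $i$-th row sums to $a_{\lambda_1-i+1}$ for all $i$. $M(v,\lambda,n)$ is the set of $M\in M(\lambda,n)$ such that the $j$-th column of $M$ sums to $1$ if $j$ is an entry of $v$ and to $0$ otherwise. $P(v,\lambda,n)$ is the convex hull of $M(v,\lambda,n)$ in $\mathbb{R}^{\lambda_1 n}$.
   Formalization: The matrices X have rational rather than real entries, and the convex hull $P(v,\lambda,n)$ is formed with rational convex coefficients. -}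

module Defs where

open import Data.Nat as ℕ using (ℕ; zero; suc; _≤ᵇ_; _∸_)
open import Data.Fin using (Fin; toℕ) renaming (zero to fzero; suc to fsuc)
open import Data.Integer as ℤ using (ℤ; +_; -[1+_])
open import Data.Rational as ℚ using (ℚ)
open import Data.List using (List; []; _∷_; length; filter)
open import Data.List.Relation.Unary.All using (All)
open import Data.List.Relation.Unary.Linked using (Linked)
open import Data.Bool using (if_then_else_)
open import Data.Product using (Σ; ∃; _×_; _,_)
open import Data.Sum using (_⊎_)
open import Relation.Nullary using (¬_)
open import Relation.Binary.PropositionalEquality using (_≡_)

Matrix : Set → ℕ → ℕ → Set
Matrix A m n = Fin m → Fin n → A

sumℤ : ∀ {n} → (Fin n → ℤ) → ℤ
sumℤ {zero}  f = + 0
sumℤ {suc n} f = f fzero ℤ.+ sumℤ (λ i → f (fsuc i))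

sumℚ : ∀ {n} → (Fin n → ℚ) → ℚ
sumℚ {zero}  f = ℚ.0ℚ
sumℚ {suc n} f = f fzero ℚ.+ sumℚ (λ i → f (fsuc i))

-- Partial sums  Σ_{j' ≤ j} f j'  (inclusive, matches 1-indexed Σ_{j'=1}^{j})
psumℤ : ∀ {n} → (Fin n → ℤ) → Fin n → ℤ
psumℤ f j = sumℤ (λ j' → if toℕ j' ≤ᵇ toℕ j then f j' else + 0)

psumℚ : ∀ {n} → (Fin n → ℚ) → Fin n → ℚ
psumℚ f j = sumℚ (λ j' → if toℕ j' ≤ᵇ toℕ j then f j' else ℚ.0ℚ)

IsPartition : List ℕ → Set
IsPartition λ' = All (0 ℕ.<_) λ' × Linked ℕ._≥_ λ'

-- λ₁ (largest part; 0 for the empty partition)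
largest : List ℕ → ℕ
largest []      = 0
largest (x ∷ _) = x

freq : List ℕ → ℕ → ℕ
freq λ' i = length (filter (ℕ._≟ i) λ')

IsSignEntry : ℤ → Set
IsSignEntry x = (x ≡ -[1+ 0 ]) ⊎ (x ≡ + 0) ⊎ (x ≡ + 1)

col : ∀ {A m n} → Matrix A m n → Fin n → Fin m → A
col M j i = M i j

IsSignMatrix : ∀ {m n} → Matrix ℤ m n → Set
IsSignMatrix {m} {n} M =
  (∀ i j → IsSignEntry (M i j)) ×
  (∀ i j → (psumℤ (col M j) i ≡ + 0) ⊎ (psumℤ (col M j) i ≡ + 1)) ×
  (∀ i j → + 0 ℤ.≤ psumℤ (M i) j)

_∈v_ : ∀ {k n} → Fin n → (Fin k → Fin n) → Set
j ∈v v = ∃ λ p → v p ≡ j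

StrictlyIncreasing : ∀ {k n} → (Fin k → Fin n) → Set
StrictlyIncreasing v = ∀ p q → toℕ p ℕ.< toℕ q → toℕ (v p) ℕ.< toℕ (v q)

-- M(v, λ, n): λ₁ × n sign matrices, row i (0-indexed, i.e. the (i+1)-th row)
-- sums to a_{λ₁ - (i+1) + 1} = a_{λ₁ - i}; column j sums to 1 if j ∈ v, else 0.
InM : ∀ {k n} (v : Fin k → Fin n) (λ' : List ℕ) → Matrix ℤ (largest λ') n → Set
InM {k} {n} v λ' M =
  IsSignMatrix M ×
  (∀ i → sumℤ (M i) ≡ + freq λ' (largest λ' ∸ toℕ i)) ×
  (∀ j → (j ∈v v → sumℤ (col M j) ≡ + 1) × (¬ (j ∈v v) → sumℤ (col M j) ≡ + 0))

toℚ : ℤ → ℚ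
toℚ z = z ℚ./ 1

InConvexHull : ∀ {m n} → (Matrix ℤ m n → Set) → Matrix ℚ m n → Set
InConvexHull {m} {n} S X =
  Σ ℕ λ r → Σ (Fin r → ℚ) λ c → Σ (Fin r → Matrix ℤ m n) λ Ms →
    (∀ t → S (Ms t)) ×
    (∀ t → ℚ.0ℚ ℚ.≤ c t) ×
    (sumℚ c ≡ ℚ.1ℚ) ×
    (∀ i j → X i j ≡ sumℚ (λ t → c t ℚ.* toℚ (Ms t i j)))

InP : ∀ {k n} (v : Fin k → Fin n) (λ' : List ℕ) → Matrix ℚ (largest λ') n → Set
InP v λ' = InConvexHull (InM v λ')

InequalityDescription : ∀ {k n} (v : Fin k → Fin n) (λ' : List ℕ) → Matrix ℚ (largest λ') n → Set
InequalityDescription {k} {n} v λ' X =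
  (∀ i j → (ℚ.0ℚ ℚ.≤ psumℚ (col X j) i) × (psumℚ (col X j) i ℚ.≤ ℚ.1ℚ)) ×
  (∀ i j → ℚ.0ℚ ℚ.≤ psumℚ (X i) j) ×
  (∀ i → sumℚ (X i) ≡ toℚ (+ freq λ' (largest λ' ∸ toℕ i))) ×
  (∀ j → (j ∈v v → sumℚ (col X j) ≡ ℚ.1ℚ) × (¬ (j ∈v v) → sumℚ (col X j) ≡ ℚ.0ℚ))

module Submission where

-- The conditions (i)–(iv) bound or fix linear functionals of X at values that every sign matrix in
-- M(v, λ, n) respects, so they pass to convex combinations.
--
-- Conversely, let X satisfy (i)–(iv) and write X = Y / D with Y integral. For k = 0, …, D - 1 round the
-- corner sums P x y = Σ_{x' < x, y' < y} Y x' y' to G_k = ⌊(P + k) / D⌋ and let M_k be the mixed second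
-- difference of G_k. A partial column sum of M_k is ⌊(A + c) / D⌋ - ⌊A / D⌋ where c is the corresponding
-- partial column sum of Y, which lies in [0, D] by (i); so it is 0 or 1, and the entries of M_k, being
-- differences of consecutive ones, lie in {-1, 0, 1}. Likewise a partial row sum of M_k is such an
-- increment with c ≥ 0 by (ii), and a full row or column sum D a of Y becomes a. Hence every M_k lies in
-- M(v, λ, n), and Hermite's identity Σ_{k < D} ⌊(N + k) / D⌋ = N gives Σ_k M_k = Y: X is the average of
-- the M_k.

open import Algebra.Bundles using (CommutativeMonoid)
open import Data.Bool using (Bool; true; false; if_then_else_)
open import Data.Fin using (Fin; toℕ; fromℕ<; combine; remQuot) renaming (zero to fzero; suc to fsuc)
open import Data.Fin.Properties using (toℕ<n; toℕ-fromℕ<; remQuot-combine)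
open import Data.Integer as ℤ using (ℤ; +_; -[1+_]; _+_; _-_; _*_; +≤+)
open import Data.Integer.DivMod using (_/ℕ_; [n/ℕd]*d≤n; n<s[n/ℕd]*d)
import Data.Integer.Properties as ℤP
open import Data.Integer.Tactic.RingSolver using (solve-∀)
open import Data.List using (List; length)
open import Data.Nat as ℕ using (ℕ; zero; suc; _≤_; _≤ᵇ_; _∸_)
import Data.Nat.Coprimality as Coprime
open import Data.Nat.DivMod using (m<n⇒m/n≡0)
import Data.Nat.Properties as ℕP
open import Data.Product using (Σ; _×_; _,_; proj₁; proj₂; uncurry)
open import Data.Rational as ℚ using (ℚ; mkℚ; 0ℚ; 1ℚ; ↥_; ↧_)
import Data.Rational.Properties as ℚP
import Data.Rational.Unnormalised as ℚᵘ
open import Data.Sum using (_⊎_; inj₁; inj₂)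
open import Function using (_∘_)
open import Relation.Nullary using (¬_)
open import Relation.Binary.PropositionalEquality

open import Defs

import Algebra.Properties.CommutativeSemigroup ℤP.+-commutativeSemigroup as ℤ+
import Algebra.Properties.CommutativeSemigroup
  (CommutativeMonoid.commutativeSemigroup ℚP.+-0-commutativeMonoid) as ℚ+

toℚ-mkℚ : ∀ a → toℚ a ≡ mkℚ a 0 (Coprime.sym (Coprime.1-coprimeTo ℤ.∣ a ∣))
toℚ-mkℚ a = ℚP.↥p/↧p≡p (mkℚ a 0 _)

toℚ-+ : ∀ a b → toℚ (a + b) ≡ toℚ a ℚ.+ toℚ b
toℚ-+ a b = begin
  toℚ (a + b)              ≡⟨ cong toℚ (sym (cong₂ _+_ (ℤP.*-identityʳ a) (ℤP.*-identityʳ b))) ⟩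
  toℚ (a * + 1 + b * + 1)  ≡⟨ sym (cong₂ ℚ._+_ (toℚ-mkℚ a) (toℚ-mkℚ b)) ⟩
  toℚ a ℚ.+ toℚ b          ∎
  where open ≡-Reasoning

toℚ-* : ∀ a b → toℚ (a * b) ≡ toℚ a ℚ.* toℚ b
toℚ-* a b = sym (cong₂ ℚ._*_ (toℚ-mkℚ a) (toℚ-mkℚ b))

toℚ-mono-≤ : ∀ {a b} → a ℤ.≤ b → toℚ a ℚ.≤ toℚ b
toℚ-mono-≤ {a} {b} a≤b rewrite toℚ-mkℚ a | toℚ-mkℚ b =
  ℚ.*≤* (subst₂ ℤ._≤_ (sym (ℤP.*-identityʳ a)) (sym (ℤP.*-identityʳ b)) a≤b)

toℚ-cancel-≤ : ∀ {a b} → toℚ a ℚ.≤ toℚ b → a ℤ.≤ b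
toℚ-cancel-≤ {a} {b} a≤b rewrite toℚ-mkℚ a | toℚ-mkℚ b =
  subst₂ ℤ._≤_ (ℤP.*-identityʳ a) (ℤP.*-identityʳ b) (ℚP.drop-*≤* a≤b)

toℚ-injective : ∀ {a b} → toℚ a ≡ toℚ b → a ≡ b
toℚ-injective {a} {b} a≡b =
  proj₁ (ℚP.mkℚ-injective (trans (sym (toℚ-mkℚ a)) (trans a≡b (toℚ-mkℚ b))))

toℚ-↥ : ∀ q → toℚ (↥ q) ≡ toℚ (↧ q) ℚ.* q
toℚ-↥ q@(mkℚ a e _) = begin
  toℚ a                            ≡⟨ sym (ℚP.fromℚᵘ-cong {ℚᵘ.mkℚᵘ (+ suc e * a) (e ℕ.+ 0)} {ℚᵘ.mkℚᵘ a 0}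
                                                          (ℚᵘ.*≡* cross)) ⟩
  (+ suc e * a) ℚ./ (1 ℕ.* suc e)  ≡⟨ cong (ℚ._* q) (sym (toℚ-mkℚ (+ suc e))) ⟩
  toℚ (+ suc e) ℚ.* q              ∎
  where
  open ≡-Reasoning
  cross : (+ suc e * a) * + 1 ≡ a * + suc (e ℕ.+ 0)
  cross rewrite ℕP.+-identityʳ e = trans (ℤP.*-identityʳ _) (ℤP.*-comm (+ suc e) a)

sumℚ-cong : ∀ {n} {f g : Fin n → ℚ} → (∀ i → f i ≡ g i) → sumℚ f ≡ sumℚ g
sumℚ-cong {zero}  f≗g = refl
sumℚ-cong {suc n} f≗g = cong₂ ℚ._+_ (f≗g fzero) (sumℚ-cong (f≗g ∘ fsuc))

sumℚ-zero : ∀ {n} → sumℚ {n} (λ _ → 0ℚ) ≡ 0ℚ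
sumℚ-zero {zero}  = refl
sumℚ-zero {suc n} = cong (0ℚ ℚ.+_) (sumℚ-zero {n})

sumℚ-distrib-+ : ∀ {n} (f g : Fin n → ℚ) → sumℚ (λ i → f i ℚ.+ g i) ≡ sumℚ f ℚ.+ sumℚ g
sumℚ-distrib-+ {zero}  f g = refl
sumℚ-distrib-+ {suc n} f g =
  trans (cong ((f fzero ℚ.+ g fzero) ℚ.+_) (sumℚ-distrib-+ (f ∘ fsuc) (g ∘ fsuc)))
        (ℚ+.interchange (f fzero) (g fzero) _ _)

*-distribˡ-sumℚ : ∀ {n} c (f : Fin n → ℚ) → c ℚ.* sumℚ f ≡ sumℚ (λ i → c ℚ.* f i)
*-distribˡ-sumℚ {zero}  c f = ℚP.*-zeroʳ c
*-distribˡ-sumℚ {suc n} c f =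
  trans (ℚP.*-distribˡ-+ c (f fzero) _) (cong (c ℚ.* f fzero ℚ.+_) (*-distribˡ-sumℚ c (f ∘ fsuc)))

sumℚ-comm : ∀ {m n} (f : Fin m → Fin n → ℚ) →
            sumℚ (λ i → sumℚ (f i)) ≡ sumℚ (λ j → sumℚ (λ i → f i j))
sumℚ-comm {zero}  {n} f = sym (sumℚ-zero {n})
sumℚ-comm {suc m}     f = trans (cong (sumℚ (f fzero) ℚ.+_) (sumℚ-comm (f ∘ fsuc)))
                                (sym (sumℚ-distrib-+ (f fzero) _))

sumℚ-mono-≤ : ∀ {n} {f g : Fin n → ℚ} → (∀ i → f i ℚ.≤ g i) → sumℚ f ℚ.≤ sumℚ g
sumℚ-mono-≤ {zero}  f≤g = ℚP.≤-refl
sumℚ-mono-≤ {suc n} f≤g = ℚP.+-mono-≤ (f≤g fzero) (sumℚ-mono-≤ (f≤g ∘ fsuc))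

sumℚ-const : ∀ n c → sumℚ {n} (λ _ → c) ≡ toℚ (+ n) ℚ.* c
sumℚ-const zero    c = sym (ℚP.*-zeroˡ c)
sumℚ-const (suc n) c = begin
  c ℚ.+ sumℚ {n} (λ _ → c)      ≡⟨ cong₂ ℚ._+_ (sym (ℚP.*-identityˡ c)) (sumℚ-const n c) ⟩
  1ℚ ℚ.* c ℚ.+ toℚ (+ n) ℚ.* c  ≡⟨ sym (ℚP.*-distribʳ-+ c 1ℚ (toℚ (+ n))) ⟩
  (1ℚ ℚ.+ toℚ (+ n)) ℚ.* c      ≡⟨ cong (ℚ._* c) (sym (toℚ-+ (+ 1) (+ n))) ⟩
  toℚ (+ suc n) ℚ.* c           ∎
  where open ≡-Reasoning

toℚ-sumℤ : ∀ {n} (f : Fin n → ℤ) → toℚ (sumℤ f) ≡ sumℚ (toℚ ∘ f)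
toℚ-sumℤ {zero}  f = refl
toℚ-sumℤ {suc n} f = trans (toℚ-+ (f fzero) _) (cong (toℚ (f fzero) ℚ.+_) (toℚ-sumℤ (f ∘ fsuc)))

weightedSum : ∀ {r} → (Fin r → ℚ) → (Fin r → ℤ) → ℚ
weightedSum c q = sumℚ (λ t → c t ℚ.* toℚ (q t))

maskedSum-weightedSum : ∀ {n r} (b : Fin n → Bool) (c : Fin r → ℚ) (ys : Fin r → Fin n → ℤ)
  {x : Fin n → ℚ} → (∀ j → x j ≡ weightedSum c (λ t → ys t j)) →
  sumℚ (λ j → if b j then x j else 0ℚ) ≡ weightedSum c (λ t → sumℤ (λ j → if b j then ys t j else + 0))
maskedSum-weightedSum {r = r} b c ys {x} x≡ = begin
  sumℚ (λ j → if b j then x j else 0ℚ)           ≡⟨ sumℚ-cong (λ j → masked j (b j)) ⟩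
  sumℚ (λ j → sumℚ (λ t → c t ℚ.* toℚ (y t j)))  ≡⟨ sumℚ-comm (λ j t → c t ℚ.* toℚ (y t j)) ⟩
  sumℚ (λ t → sumℚ (λ j → c t ℚ.* toℚ (y t j)))  ≡⟨ sumℚ-cong (λ t → sym (*-distribˡ-sumℚ (c t) (toℚ ∘ y t))) ⟩
  sumℚ (λ t → c t ℚ.* sumℚ (toℚ ∘ y t))          ≡⟨ sumℚ-cong (λ t → cong (c t ℚ.*_) (sym (toℚ-sumℤ (y t)))) ⟩
  weightedSum c (λ t → sumℤ (y t))               ∎
  where
  open ≡-Reasoning
  y : Fin r → Fin _ → ℤ
  y t j = if b j then ys t j else + 0
  masked : ∀ j β → (if β then x j else 0ℚ) ≡ weightedSum c (λ t → if β then ys t j else + 0)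
  masked j true  = x≡ j
  masked j false = sym (trans (sumℚ-cong (λ t → ℚP.*-zeroʳ (c t))) (sumℚ-zero {r}))

weightedSum-const : ∀ {r} {c : Fin r → ℚ} {q : Fin r → ℤ} {a} →
                    sumℚ c ≡ 1ℚ → (∀ t → q t ≡ a) → weightedSum c q ≡ toℚ a
weightedSum-const {c = c} {q} {a} Σc≡1 q≡a = begin
  sumℚ (λ t → c t ℚ.* toℚ (q t))  ≡⟨ sumℚ-cong (λ t → trans (cong (λ z → c t ℚ.* toℚ z) (q≡a t))
                                                           (ℚP.*-comm (c t) (toℚ a))) ⟩
  sumℚ (λ t → toℚ a ℚ.* c t)      ≡⟨ sym (*-distribˡ-sumℚ (toℚ a) c) ⟩
  toℚ a ℚ.* sumℚ c                ≡⟨ cong (toℚ a ℚ.*_) Σc≡1 ⟩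
  toℚ a ℚ.* 1ℚ                    ≡⟨ ℚP.*-identityʳ (toℚ a) ⟩
  toℚ a                           ∎
  where open ≡-Reasoning

weightedSum-mono-≤ : ∀ {r} {c : Fin r → ℚ} {p q : Fin r → ℤ} →
                     (∀ t → 0ℚ ℚ.≤ c t) → (∀ t → p t ℤ.≤ q t) → weightedSum c p ℚ.≤ weightedSum c q
weightedSum-mono-≤ {c = c} c≥0 p≤q =
  sumℚ-mono-≤ (λ t → ℚP.*-monoˡ-≤-nonNeg (c t) {{ℚ.nonNegative (c≥0 t)}} (toℚ-mono-≤ (p≤q t)))

module _ {r} {c : Fin r → ℚ} (c≥0 : ∀ t → 0ℚ ℚ.≤ c t) (Σc≡1 : sumℚ c ≡ 1ℚ) {q : Fin r → ℤ} where

  weightedSum-≥ : ∀ {a} → (∀ t → a ℤ.≤ q t) → toℚ a ℚ.≤ weightedSum c q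
  weightedSum-≥ {a} a≤q =
    subst (ℚ._≤ weightedSum c q) (weightedSum-const {c = c} {q = λ _ → a} Σc≡1 (λ _ → refl))
          (weightedSum-mono-≤ c≥0 a≤q)

  weightedSum-≤ : ∀ {a} → (∀ t → q t ℤ.≤ a) → weightedSum c q ℚ.≤ toℚ a
  weightedSum-≤ {a} q≤a =
    subst (weightedSum c q ℚ.≤_) (weightedSum-const {c = c} {q = λ _ → a} Σc≡1 (λ _ → refl))
          (weightedSum-mono-≤ c≥0 q≤a)

-- Clearing denominators

toℚ-maskedSum : ∀ {n} (b : Fin n → Bool) κ (y : Fin n → ℤ) {x : Fin n → ℚ} →
  (∀ j → toℚ (y j) ≡ κ ℚ.* x j) →
  toℚ (sumℤ (λ j → if b j then y j else + 0)) ≡ κ ℚ.* sumℚ (λ j → if b j then x j else 0ℚ)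
toℚ-maskedSum b κ y {x} y≡κx = begin
  toℚ (sumℤ (λ j → if b j then y j else + 0))   ≡⟨ toℚ-sumℤ (λ j → if b j then y j else + 0) ⟩
  sumℚ (λ j → toℚ (if b j then y j else + 0))   ≡⟨ sumℚ-cong (λ j → masked j (b j)) ⟩
  sumℚ (λ j → κ ℚ.* (if b j then x j else 0ℚ))  ≡⟨ sym (*-distribˡ-sumℚ κ (λ j → if b j then x j else 0ℚ)) ⟩
  κ ℚ.* sumℚ (λ j → if b j then x j else 0ℚ)    ∎
  where
  open ≡-Reasoning
  masked : ∀ j β → toℚ (if β then y j else + 0) ≡ κ ℚ.* (if β then x j else 0ℚ)
  masked j true  = y≡κx j
  masked j false = sym (ℚP.*-zeroʳ κ)

module _ (D : ℕ) {z : ℤ} {q : ℚ} (z≡Dq : toℚ z ≡ toℚ (+ D) ℚ.* q) where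

  private
    instance
      D≥0 : ℚ.NonNegative (toℚ (+ D))
      D≥0 = ℚ.nonNegative (toℚ-mono-≤ {+ 0} {+ D} (+≤+ ℕ.z≤n))

  scaled-nonNeg : 0ℚ ℚ.≤ q → + 0 ℤ.≤ z
  scaled-nonNeg 0≤q = toℚ-cancel-≤ (begin
    0ℚ                ≡⟨ sym (ℚP.*-zeroʳ (toℚ (+ D))) ⟩
    toℚ (+ D) ℚ.* 0ℚ  ≤⟨ ℚP.*-monoˡ-≤-nonNeg (toℚ (+ D)) 0≤q ⟩
    toℚ (+ D) ℚ.* q   ≡⟨ sym z≡Dq ⟩
    toℚ z             ∎)
    where open ℚP.≤-Reasoning

  scaled-≤ : q ℚ.≤ 1ℚ → z ℤ.≤ + D
  scaled-≤ q≤1 = toℚ-cancel-≤ (begin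
    toℚ z             ≡⟨ z≡Dq ⟩
    toℚ (+ D) ℚ.* q   ≤⟨ ℚP.*-monoˡ-≤-nonNeg (toℚ (+ D)) q≤1 ⟩
    toℚ (+ D) ℚ.* 1ℚ  ≡⟨ ℚP.*-identityʳ (toℚ (+ D)) ⟩
    toℚ (+ D)         ∎)
    where open ℚP.≤-Reasoning

  scaled-≡ : ∀ a → q ≡ toℚ a → z ≡ + D * a
  scaled-≡ a q≡a =
    toℚ-injective (trans z≡Dq (trans (cong (toℚ (+ D) ℚ.*_) q≡a) (sym (toℚ-* (+ D) a))))

infix 4 _Clears_
_Clears_ : ℕ → ℚ → Set
D Clears q = Σ ℤ λ a → toℚ a ≡ toℚ (+ D) ℚ.* q

↧-clears : ∀ q → ℚ.↧ₙ q Clears q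
↧-clears q = ↥ q , toℚ-↥ q

clears-*ˡ : ∀ {D q} E → D Clears q → E ℕ.* D Clears q
clears-*ˡ {D} {q} E (a , a≡Dq) = + E * a , (begin
  toℚ (+ E * a)                    ≡⟨ toℚ-* (+ E) a ⟩
  toℚ (+ E) ℚ.* toℚ a              ≡⟨ cong (toℚ (+ E) ℚ.*_) a≡Dq ⟩
  toℚ (+ E) ℚ.* (toℚ (+ D) ℚ.* q)  ≡⟨ sym (ℚP.*-assoc (toℚ (+ E)) (toℚ (+ D)) q) ⟩
  toℚ (+ E) ℚ.* toℚ (+ D) ℚ.* q    ≡⟨ cong (ℚ._* q) (sym (toℚ-* (+ E) (+ D))) ⟩
  toℚ (+ E * + D) ℚ.* q            ≡⟨ cong (λ z → toℚ z ℚ.* q) (sym (ℤP.pos-* E D)) ⟩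
  toℚ (+ (E ℕ.* D)) ℚ.* q          ∎)
  where open ≡-Reasoning

clears-*ʳ : ∀ {D q} E → D Clears q → D ℕ.* E Clears q
clears-*ʳ {D} {q} E clears = subst (_Clears q) (ℕP.*-comm E D) (clears-*ˡ E clears)

commonDenominator : ∀ {n} (f : Fin n → ℚ) → Σ ℕ λ d → ∀ j → suc d Clears f j
commonDenominator {zero}  f = 0 , λ ()
commonDenominator {suc n} f with commonDenominator (f ∘ fsuc)
... | d , clears = d ℕ.+ ℚ.denominator-1 (f fzero) ℕ.* suc d , clears′
  where
  clears′ : ∀ j → ℚ.↧ₙ (f fzero) ℕ.* suc d Clears f j
  clears′ fzero    = clears-*ʳ {D = ℚ.↧ₙ (f fzero)} (suc d) (↧-clears (f fzero))
  clears′ (fsuc j) = clears-*ˡ {D = suc d} (ℚ.↧ₙ (f fzero)) (clears j)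

commonDenominator-matrix : ∀ {m n} (X : Matrix ℚ m n) → Σ ℕ λ d → ∀ i j → suc d Clears X i j
commonDenominator-matrix {m} {n} X with commonDenominator (uncurry X ∘ remQuot n)
... | d , clears = d , λ i j →
  subst (λ ij → suc d Clears uncurry X ij) (remQuot-combine i j) (clears (combine i j))

1/suc : ℕ → ℚ
1/suc d = ℚ.1/ mkℚ (+ suc d) 0 (Coprime.sym (Coprime.1-coprimeTo (suc d)))

toℚ-suc*1/suc : ∀ d → toℚ (+ suc d) ℚ.* 1/suc d ≡ 1ℚ
toℚ-suc*1/suc d = trans (cong (ℚ._* 1/suc d) (toℚ-mkℚ (+ suc d)))
  (ℚP.*-inverseʳ (mkℚ (+ suc d) 0 (Coprime.sym (Coprime.1-coprimeTo (suc d)))))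

sumℚ-1/suc : ∀ d → sumℚ {suc d} (λ _ → 1/suc d) ≡ 1ℚ
sumℚ-1/suc d = trans (sumℚ-const (suc d) (1/suc d)) (toℚ-suc*1/suc d)

scaledSum⇒average : ∀ d (z : Fin (suc d) → ℤ) {x} → toℚ (sumℤ z) ≡ toℚ (+ suc d) ℚ.* x →
                    x ≡ weightedSum (λ _ → 1/suc d) z
scaledSum⇒average d z {x} Σz≡Dx = begin
  x                              ≡⟨ sym (ℚP.*-identityˡ x) ⟩
  1ℚ ℚ.* x                       ≡⟨ cong (ℚ._* x) (sym (trans (ℚP.*-comm (1/suc d) D) (toℚ-suc*1/suc d))) ⟩
  1/suc d ℚ.* D ℚ.* x            ≡⟨ ℚP.*-assoc (1/suc d) D x ⟩
  1/suc d ℚ.* (D ℚ.* x)          ≡⟨ cong (1/suc d ℚ.*_) (trans (sym Σz≡Dx) (toℚ-sumℤ z)) ⟩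
  1/suc d ℚ.* sumℚ (toℚ ∘ z)     ≡⟨ *-distribˡ-sumℚ (1/suc d) (toℚ ∘ z) ⟩
  weightedSum (λ _ → 1/suc d) z  ∎
  where
  open ≡-Reasoning
  D = toℚ (+ suc d)

Is01 : ℤ → Set
Is01 z = (z ≡ + 0) ⊎ (z ≡ + 1)

Is01-nonNeg : ∀ {z} → Is01 z → + 0 ℤ.≤ z
Is01-nonNeg (inj₁ refl) = +≤+ ℕ.z≤n
Is01-nonNeg (inj₂ refl) = +≤+ ℕ.z≤n

Is01-≤1 : ∀ {z} → Is01 z → z ℤ.≤ + 1
Is01-≤1 (inj₁ refl) = +≤+ ℕ.z≤n
Is01-≤1 (inj₂ refl) = +≤+ (ℕ.s≤s ℕ.z≤n)

Is01-from-bounds : ∀ {z} → + 0 ℤ.≤ z → z ℤ.≤ + 1 → Is01 z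
Is01-from-bounds {+ 0}           _ _                  = inj₁ refl
Is01-from-bounds {+ 1}           _ _                  = inj₂ refl
Is01-from-bounds {+ suc (suc _)} _ (+≤+ (ℕ.s≤s ()))
Is01-from-bounds { -[1+ _ ]}     () _

Is01-difference : ∀ {a b} → Is01 a → Is01 b → IsSignEntry (a - b)
Is01-difference (inj₁ refl) (inj₁ refl) = inj₂ (inj₁ refl)
Is01-difference (inj₁ refl) (inj₂ refl) = inj₁ refl
Is01-difference (inj₂ refl) (inj₁ refl) = inj₂ (inj₂ refl)
Is01-difference (inj₂ refl) (inj₂ refl) = inj₂ (inj₁ refl)

sumℤ-cong : ∀ {n} {f g : Fin n → ℤ} → (∀ i → f i ≡ g i) → sumℤ f ≡ sumℤ g
sumℤ-cong {zero}  f≗g = refl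
sumℤ-cong {suc n} f≗g = cong₂ _+_ (f≗g fzero) (sumℤ-cong (f≗g ∘ fsuc))

sumℤ-zero : ∀ {n} → sumℤ {n} (λ _ → + 0) ≡ + 0
sumℤ-zero {zero}  = refl
sumℤ-zero {suc n} = trans (ℤP.+-identityˡ _) (sumℤ-zero {n})

sumℤ-distrib-+ : ∀ {n} (f g : Fin n → ℤ) → sumℤ (λ i → f i + g i) ≡ sumℤ f + sumℤ g
sumℤ-distrib-+ {zero}  f g = refl
sumℤ-distrib-+ {suc n} f g =
  trans (cong (λ s → (f fzero + g fzero) + s) (sumℤ-distrib-+ (f ∘ fsuc) (g ∘ fsuc)))
        (ℤ+.interchange (f fzero) (g fzero) _ _)

sumℤ-distrib-minus : ∀ {n} (f g : Fin n → ℤ) → sumℤ (λ i → f i - g i) ≡ sumℤ f - sumℤ g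
sumℤ-distrib-minus {zero}  f g = refl
sumℤ-distrib-minus {suc n} f g =
  trans (cong (λ s → (f fzero - g fzero) + s) (sumℤ-distrib-minus (f ∘ fsuc) (g ∘ fsuc)))
        (interchange-minus (f fzero) (g fzero) _ _)
  where
  interchange-minus : ∀ a b c e → (a - b) + (c - e) ≡ (a + c) - (b + e)
  interchange-minus = solve-∀

sumBelow : ℕ → (ℕ → ℤ) → ℤ
sumBelow a f = sumℤ {a} (f ∘ toℕ)

sumBelow-cong : ∀ a {f g : ℕ → ℤ} → (∀ x → x ℕ.< a → f x ≡ g x) → sumBelow a f ≡ sumBelow a g
sumBelow-cong a f≗g = sumℤ-cong (λ i → f≗g (toℕ i) (toℕ<n i))

sumBelow-snoc : ∀ a (f : ℕ → ℤ) → sumBelow (suc a) f ≡ sumBelow a f + f a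
sumBelow-snoc zero    f = ℤP.+-comm (f 0) (+ 0)
sumBelow-snoc (suc a) f =
  trans (cong (λ s → f 0 + s) (sumBelow-snoc a (f ∘ suc))) (sym (ℤP.+-assoc (f 0) _ _))

sumBelow-telescope : ∀ a (g : ℕ → ℤ) → sumBelow a (λ x → g (suc x) - g x) ≡ g a - g 0
sumBelow-telescope zero    g = sym (ℤP.+-inverseʳ (g 0))
sumBelow-telescope (suc a) g = begin
  (g 1 - g 0) + sumBelow a (λ x → g (suc (suc x)) - g (suc x))
    ≡⟨ cong (λ s → (g 1 - g 0) + s) (sumBelow-telescope a (g ∘ suc)) ⟩
  (g 1 - g 0) + (g (suc a) - g 1)
    ≡⟨ ℤP.+-comm (g 1 - g 0) _ ⟩
  (g (suc a) - g 1) + (g 1 - g 0)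
    ≡⟨ ℤP.+-minus-telescope (g (suc a)) (g 1) (g 0) ⟩
  g (suc a) - g 0 ∎
  where open ≡-Reasoning

suc-≤ᵇ-suc : ∀ x y → (suc x ≤ᵇ suc y) ≡ (x ≤ᵇ y)
suc-≤ᵇ-suc zero    y = refl
suc-≤ᵇ-suc (suc x) y = refl

psumℤ-sumBelow : ∀ {n} {g : Fin n → ℤ} (h : ℕ → ℤ) → (∀ j → h (toℕ j) ≡ g j) →
                 ∀ i → psumℤ g i ≡ sumBelow (suc (toℕ i)) h
psumℤ-sumBelow {suc n}     h h≡g fzero    = cong₂ _+_ (sym (h≡g fzero)) (sumℤ-zero {n})
psumℤ-sumBelow {suc n} {g} h h≡g (fsuc i) = cong₂ _+_ (sym (h≡g fzero)) (begin
  sumℤ (λ j → if suc (toℕ j) ≤ᵇ suc (toℕ i) then g (fsuc j) else + 0)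
    ≡⟨ sumℤ-cong (λ j → cong (λ β → if β then g (fsuc j) else + 0) (suc-≤ᵇ-suc (toℕ j) (toℕ i))) ⟩
  psumℤ (g ∘ fsuc) i
    ≡⟨ psumℤ-sumBelow (h ∘ suc) (h≡g ∘ fsuc) i ⟩
  sumBelow (suc (toℕ i)) (h ∘ suc) ∎)
  where open ≡-Reasoning

extend : ∀ {n} → (Fin n → ℤ) → ℕ → ℤ
extend {zero}  g _       = + 0
extend {suc n} g zero    = g fzero
extend {suc n} g (suc x) = extend (g ∘ fsuc) x

extend-toℕ : ∀ {n} (g : Fin n → ℤ) j → extend g (toℕ j) ≡ g j
extend-toℕ g fzero    = refl
extend-toℕ g (fsuc j) = extend-toℕ (g ∘ fsuc) j

Δˣ Δʸ Δ² : (ℕ → ℕ → ℤ) → ℕ → ℕ → ℤ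
Δˣ F x y = F (suc x) y - F x y
Δʸ F x y = F x (suc y) - F x y
Δ² F x y = Δʸ F (suc x) y - Δʸ F x y

Δ²≡Δˣ-Δˣ : ∀ F x y → Δ² F x y ≡ Δˣ F x (suc y) - Δˣ F x y
Δ²≡Δˣ-Δˣ F x y = swap-middle (F (suc x) (suc y)) (F (suc x) y) (F x (suc y)) (F x y)
  where
  swap-middle : ∀ a b c e → (a - b) - (c - e) ≡ (a - c) - (b - e)
  swap-middle = solve-∀

Δ²-cong : ∀ {F F′ : ℕ → ℕ → ℤ} → (∀ x y → F x y ≡ F′ x y) → ∀ x y → Δ² F x y ≡ Δ² F′ x y
Δ²-cong F≗F′ x y = cong₂ _-_ (cong₂ _-_ (F≗F′ (suc x) (suc y)) (F≗F′ (suc x) y))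
                             (cong₂ _-_ (F≗F′ x (suc y)) (F≗F′ x y))

sumℤ-Δ² : ∀ {r} (F : Fin r → ℕ → ℕ → ℤ) x y →
          sumℤ (λ t → Δ² (F t) x y) ≡ Δ² (λ x y → sumℤ (λ t → F t x y)) x y
sumℤ-Δ² F x y = trans (sumℤ-distrib-minus (λ t → Δʸ (F t) (suc x) y) (λ t → Δʸ (F t) x y))
  (cong₂ _-_ (sumℤ-distrib-minus (λ t → F t (suc x) (suc y)) (λ t → F t (suc x) y))
             (sumℤ-distrib-minus (λ t → F t x (suc y)) (λ t → F t x y)))

sumBelow-Δ²ˣ : ∀ F a y → sumBelow a (λ x → Δ² F x y) ≡ Δʸ F a y - Δʸ F 0 y
sumBelow-Δ²ˣ F a y = sumBelow-telescope a (λ x → Δʸ F x y)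

sumBelow-Δ²ʸ : ∀ F x b → sumBelow b (λ y → Δ² F x y) ≡ Δˣ F x b - Δˣ F x 0
sumBelow-Δ²ʸ F x b =
  trans (sumBelow-cong b (λ y _ → Δ²≡Δˣ-Δˣ F x y)) (sumBelow-telescope b (Δˣ F x))

-- Rounding an integral matrix into sign matrices

module Floor (d : ℕ) where

  D : ℤ
  D = + suc d

  private
    multiples-≤ : ∀ {a q r} → q * D ℤ.≤ a → a ℤ.< ℤ.suc r * D → q ℤ.≤ r
    multiples-≤ {a} {q} {r} qD≤a a<[1+r]D = subst₂ ℤ._≤_ (ℤP.pred-suc q) (ℤP.pred-suc r)
      (ℤP.pred-mono (ℤP.i<j⇒suc[i]≤j (ℤP.*-cancelʳ-<-nonNeg {q} {ℤ.suc r} D (ℤP.≤-<-trans qD≤a a<[1+r]D))))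

  /ℕ-unique : ∀ {a q} → q * D ℤ.≤ a → a ℤ.< ℤ.suc q * D → a /ℕ suc d ≡ q
  /ℕ-unique {a} qD≤a a<[1+q]D = ℤP.≤-antisym (multiples-≤ ([n/ℕd]*d≤n a (suc d)) a<[1+q]D)
                                             (multiples-≤ qD≤a (n<s[n/ℕd]*d a (suc d)))

  /ℕ-mono-≤ : ∀ {a b} → a ℤ.≤ b → a /ℕ suc d ℤ.≤ b /ℕ suc d
  /ℕ-mono-≤ {a} {b} a≤b = multiples-≤ (ℤP.≤-trans ([n/ℕd]*d≤n a (suc d)) a≤b) (n<s[n/ℕd]*d b (suc d))

  +-*-/ℕ : ∀ a c → (a + c * D) /ℕ suc d ≡ a /ℕ suc d + c
  +-*-/ℕ a c = /ℕ-unique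
    (subst (ℤ._≤ a + c * D) (sym (ℤP.*-distribʳ-+ D q c)) (ℤP.+-monoˡ-≤ (c * D) ([n/ℕd]*d≤n a (suc d))))
    (subst (a + c * D ℤ.<_) (distrib q c D) (ℤP.+-monoˡ-< (c * D) (n<s[n/ℕd]*d a (suc d))))
    where
    q = a /ℕ suc d
    distrib : ∀ q c D → (+ 1 + q) * D + c * D ≡ (+ 1 + (q + c)) * D
    distrib = solve-∀

  increment : ℤ → ℤ → ℤ
  increment a c = (a + c) /ℕ suc d - a /ℕ suc d

  increment-zero : ∀ a → increment a (+ 0) ≡ + 0
  increment-zero a =
    trans (cong (λ z → z /ℕ suc d - a /ℕ suc d) (ℤP.+-identityʳ a)) (ℤP.+-inverseʳ (a /ℕ suc d))

  increment-multiple : ∀ a c → increment a (D * c) ≡ c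
  increment-multiple a c = begin
    (a + D * c) /ℕ suc d - q  ≡⟨ cong (λ z → (a + z) /ℕ suc d - q) (ℤP.*-comm D c) ⟩
    (a + c * D) /ℕ suc d - q  ≡⟨ cong (λ z → z - q) (+-*-/ℕ a c) ⟩
    (q + c) - q               ≡⟨ [q+c]-q≡c q c ⟩
    c                         ∎
    where
    open ≡-Reasoning
    q = a /ℕ suc d
    [q+c]-q≡c : ∀ q c → (q + c) - q ≡ c
    [q+c]-q≡c = solve-∀

  increment-mono-≤ : ∀ a {c c′} → c ℤ.≤ c′ → increment a c ℤ.≤ increment a c′
  increment-mono-≤ a c≤c′ = ℤP.+-monoˡ-≤ (ℤ.- (a /ℕ suc d)) (/ℕ-mono-≤ (ℤP.+-monoʳ-≤ a c≤c′))

  increment-nonNeg : ∀ a {c} → + 0 ℤ.≤ c → + 0 ℤ.≤ increment a c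
  increment-nonNeg a {c} 0≤c = subst (ℤ._≤ increment a c) (increment-zero a) (increment-mono-≤ a 0≤c)

  increment-01 : ∀ a {c} → + 0 ℤ.≤ c → c ℤ.≤ D → Is01 (increment a c)
  increment-01 a {c} 0≤c c≤D = Is01-from-bounds (increment-nonNeg a 0≤c)
    (subst (increment a c ℤ.≤_) (increment-multiple a (+ 1))
           (increment-mono-≤ a (subst (c ℤ.≤_) (sym (ℤP.*-identityʳ D)) c≤D)))

  private
    H : ℤ → ℤ
    H N = sumBelow (suc d) (λ k → (N + + k) /ℕ suc d)

    H-zero : H (+ 0) ≡ + 0
    H-zero = trans (sumBelow-cong (suc d) (λ k k<D → cong +_ (m<n⇒m/n≡0 k<D))) (sumℤ-zero {suc d})

    H-suc : ∀ N → H (ℤ.suc N) ≡ ℤ.suc (H N)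
    H-suc N = begin
      H (ℤ.suc N)
        ≡⟨ sumBelow-cong (suc d) (λ k _ → cong (_/ℕ suc d) (ℤ+.xy∙z≈y∙xz (+ 1) N (+ k))) ⟩
      sumBelow (suc d) (f ∘ suc)
        ≡⟨ x≡[a+x]-a (f 0) _ ⟩
      sumBelow (suc (suc d)) f - f 0
        ≡⟨ cong (λ z → z - f 0) (sumBelow-snoc (suc d) f) ⟩
      (H N + f (suc d)) - f 0
        ≡⟨ cong (λ z → (H N + z) - f 0) f[D]≡f[0]+1 ⟩
      (H N + (f 0 + + 1)) - f 0
        ≡⟨ [h+[a+1]]-a≡1+h (H N) (f 0) ⟩
      ℤ.suc (H N) ∎
      where
      open ≡-Reasoning
      f : ℕ → ℤ
      f k = (N + + k) /ℕ suc d
      f[D]≡f[0]+1 : f (suc d) ≡ f 0 + + 1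
      f[D]≡f[0]+1 = begin
        (N + D) /ℕ suc d        ≡⟨ cong (λ z → (N + z) /ℕ suc d) (sym (ℤP.*-identityˡ D)) ⟩
        (N + + 1 * D) /ℕ suc d  ≡⟨ +-*-/ℕ N (+ 1) ⟩
        N /ℕ suc d + + 1        ≡⟨ cong (λ z → z /ℕ suc d + + 1) (sym (ℤP.+-identityʳ N)) ⟩
        f 0 + + 1               ∎
      x≡[a+x]-a : ∀ a x → x ≡ (a + x) - a
      x≡[a+x]-a = solve-∀
      [h+[a+1]]-a≡1+h : ∀ h a → (h + (a + + 1)) - a ≡ + 1 + h
      [h+[a+1]]-a≡1+h = solve-∀

    suc-injective : ∀ {a b} → ℤ.suc a ≡ ℤ.suc b → a ≡ b
    suc-injective {a} {b} eq = trans (sym (ℤP.pred-suc a)) (trans (cong ℤ.pred eq) (ℤP.pred-suc b))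

  -- Hermite's identity ⌊D x⌋ = Σ_{k < D} ⌊x + k / D⌋ at x = N / D.
  hermite : ∀ N → sumBelow (suc d) (λ k → (N + + k) /ℕ suc d) ≡ N
  hermite (+ zero)     = H-zero
  hermite (+ suc n)    = trans (H-suc (+ n)) (cong ℤ.suc (hermite (+ n)))
  hermite -[1+ zero ]  = suc-injective (trans (sym (H-suc -[1+ 0 ])) H-zero)
  hermite -[1+ suc n ] = suc-injective (trans (sym (H-suc -[1+ suc n ])) (hermite -[1+ n ]))

module Rounding (d : ℕ) {m n : ℕ} (Y : Matrix ℤ m n) where
  open Floor d

  Ŷ : ℕ → ℕ → ℤ
  Ŷ x y = extend (λ i → extend (Y i) y) x

  Ŷ-toℕ : ∀ i j → Ŷ (toℕ i) (toℕ j) ≡ Y i j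
  Ŷ-toℕ i j = trans (extend-toℕ (λ i → extend (Y i) (toℕ j)) i) (extend-toℕ (Y i) j)

  colPrefix rowPrefix corner : ℕ → ℕ → ℤ
  colPrefix x y = sumBelow x (λ x′ → Ŷ x′ y)
  rowPrefix x y = sumBelow y (Ŷ x)
  corner    x y = sumBelow x (λ x′ → rowPrefix x′ y)

  corner-sucˣ : ∀ x y → corner (suc x) y ≡ corner x y + rowPrefix x y
  corner-sucˣ x y = sumBelow-snoc x (λ x′ → rowPrefix x′ y)

  corner-sucʸ : ∀ x y → corner x (suc y) ≡ corner x y + colPrefix x y
  corner-sucʸ x y = trans (sumBelow-cong x (λ x′ _ → sumBelow-snoc y (Ŷ x′)))
                          (sumℤ-distrib-+ {x} (λ i → rowPrefix (toℕ i) y) (λ i → Ŷ (toℕ i) y))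

  private
    [a+b]-a≡b : ∀ a b → (a + b) - a ≡ b
    [a+b]-a≡b = solve-∀

  Δ²-corner : ∀ x y → Δ² corner x y ≡ Ŷ x y
  Δ²-corner x y = begin
    Δ² corner x y                            ≡⟨ Δ²≡Δˣ-Δˣ corner x y ⟩
    Δˣ corner x (suc y) - Δˣ corner x y      ≡⟨ cong₂ _-_ (Δˣ-corner (suc y)) (Δˣ-corner y) ⟩
    rowPrefix x (suc y) - rowPrefix x y      ≡⟨ cong (λ z → z - rowPrefix x y) (sumBelow-snoc y (Ŷ x)) ⟩
    (rowPrefix x y + Ŷ x y) - rowPrefix x y  ≡⟨ [a+b]-a≡b (rowPrefix x y) (Ŷ x y) ⟩
    Ŷ x y                                    ∎
    where
    open ≡-Reasoning
    Δˣ-corner : ∀ y → Δˣ corner x y ≡ rowPrefix x y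
    Δˣ-corner y = trans (cong (λ z → z - corner x y) (corner-sucˣ x y))
                        ([a+b]-a≡b (corner x y) (rowPrefix x y))

  shifted : ℕ → ℕ → ℕ → ℤ
  shifted k x y = corner x y + + k

  G : ℕ → ℕ → ℕ → ℤ
  G k x y = shifted k x y /ℕ suc d

  M : Fin (suc d) → Matrix ℤ m n
  M k i j = Δ² (G (toℕ k)) (toℕ i) (toℕ j)

  Δʸ-G : ∀ k x y → Δʸ (G k) x y ≡ increment (shifted k x y) (colPrefix x y)
  Δʸ-G k x y = cong (λ z → z /ℕ suc d - G k x y)
    (trans (cong (_+ + k) (corner-sucʸ x y)) (ℤ+.xy∙z≈xz∙y (corner x y) (colPrefix x y) (+ k)))

  Δˣ-G : ∀ k x y → Δˣ (G k) x y ≡ increment (shifted k x y) (rowPrefix x y)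
  Δˣ-G k x y = cong (λ z → z /ℕ suc d - G k x y)
    (trans (cong (_+ + k) (corner-sucˣ x y)) (ℤ+.xy∙z≈xz∙y (corner x y) (rowPrefix x y) (+ k)))

  private
    minus-zero : ∀ a {b} → b ≡ + 0 → a - b ≡ a
    minus-zero a b≡0 = trans (cong (a -_) b≡0) (ℤP.+-identityʳ a)

  sumBelow-Δ²Gˣ : ∀ k a y → sumBelow a (λ x → Δ² (G k) x y) ≡ Δʸ (G k) a y
  sumBelow-Δ²Gˣ k a y = trans (sumBelow-Δ²ˣ (G k) a y)
    (minus-zero (Δʸ (G k) a y) (trans (Δʸ-G k 0 y) (increment-zero (shifted k 0 y))))

  sumBelow-Δ²Gʸ : ∀ k x b → sumBelow b (λ y → Δ² (G k) x y) ≡ Δˣ (G k) x b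
  sumBelow-Δ²Gʸ k x b = trans (sumBelow-Δ²ʸ (G k) x b)
    (minus-zero (Δˣ (G k) x b) (trans (Δˣ-G k x 0) (increment-zero (shifted k x 0))))

  sumℤ-M : ∀ i j → sumℤ (λ k → M k i j) ≡ Y i j
  sumℤ-M i j = begin
    sumℤ (λ k → M k i j)                               ≡⟨ sumℤ-Δ² {suc d} (G ∘ toℕ) x y ⟩
    Δ² (λ x y → sumBelow (suc d) (λ k → G k x y)) x y  ≡⟨ Δ²-cong (λ x y → hermite (corner x y)) x y ⟩
    Δ² corner x y                                      ≡⟨ Δ²-corner x y ⟩
    Ŷ x y                                              ≡⟨ Ŷ-toℕ i j ⟩
    Y i j                                              ∎
    where
    open ≡-Reasoning
    x = toℕ i
    y = toℕ j

  M-colSum : ∀ k j c → sumℤ (col Y j) ≡ D * c → sumℤ (col (M k) j) ≡ c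
  M-colSum k j c ΣY≡Dc = begin
    sumℤ (col (M k) j)                  ≡⟨ sumBelow-Δ²Gˣ (toℕ k) m (toℕ j) ⟩
    Δʸ (G (toℕ k)) m (toℕ j)            ≡⟨ Δʸ-G (toℕ k) m (toℕ j) ⟩
    increment a (colPrefix m (toℕ j))   ≡⟨ cong (increment a) (trans (sumℤ-cong (λ i → Ŷ-toℕ i j)) ΣY≡Dc) ⟩
    increment a (D * c)                 ≡⟨ increment-multiple a c ⟩
    c                                   ∎
    where
    open ≡-Reasoning
    a = shifted (toℕ k) m (toℕ j)

  M-rowSum : ∀ k i c → sumℤ (Y i) ≡ D * c → sumℤ (M k i) ≡ c
  M-rowSum k i c ΣY≡Dc = begin
    sumℤ (M k i)                        ≡⟨ sumBelow-Δ²Gʸ (toℕ k) (toℕ i) n ⟩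
    Δˣ (G (toℕ k)) (toℕ i) n            ≡⟨ Δˣ-G (toℕ k) (toℕ i) n ⟩
    increment a (rowPrefix (toℕ i) n)   ≡⟨ cong (increment a) (trans (sumℤ-cong (Ŷ-toℕ i)) ΣY≡Dc) ⟩
    increment a (D * c)                 ≡⟨ increment-multiple a c ⟩
    c                                   ∎
    where
    open ≡-Reasoning
    a = shifted (toℕ k) (toℕ i) n

  module _ (colBounds : ∀ i j → + 0 ℤ.≤ psumℤ (col Y j) i × psumℤ (col Y j) i ℤ.≤ D)
           (rowNonNeg : ∀ i j → + 0 ℤ.≤ psumℤ (Y i) j) where

    private
      Δʸ-G-01 : ∀ k x → x ≤ m → ∀ (j : Fin n) → Is01 (Δʸ (G k) x (toℕ j))
      Δʸ-G-01 k zero    _   j = inj₁ (trans (Δʸ-G k 0 (toℕ j)) (increment-zero (shifted k 0 (toℕ j))))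
      Δʸ-G-01 k (suc x) x<m j = subst Is01 (sym (Δʸ-G k (suc x) (toℕ j)))
                                      (uncurry (increment-01 (shifted k (suc x) (toℕ j))) bounds)
        where
        i = fromℕ< x<m
        bounds : + 0 ℤ.≤ colPrefix (suc x) (toℕ j) × colPrefix (suc x) (toℕ j) ℤ.≤ D
        bounds = subst (λ z → + 0 ℤ.≤ z × z ℤ.≤ D)
                       (trans (psumℤ-sumBelow (λ x → Ŷ x (toℕ j)) (λ i′ → Ŷ-toℕ i′ j) i)
                              (cong (λ z → colPrefix (suc z) (toℕ j)) (toℕ-fromℕ< x<m)))
                       (colBounds i j)

    M-isSignMatrix : ∀ k → IsSignMatrix (M k)
    M-isSignMatrix k = entries , colPSums , rowPSums
      where
      entries : ∀ i j → IsSignEntry (M k i j)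
      entries i j = Is01-difference (Δʸ-G-01 (toℕ k) (suc (toℕ i)) (toℕ<n i) j)
                                    (Δʸ-G-01 (toℕ k) (toℕ i) (ℕP.<⇒≤ (toℕ<n i)) j)
      colPSums : ∀ i j → Is01 (psumℤ (col (M k) j) i)
      colPSums i j = subst Is01
        (sym (trans (psumℤ-sumBelow (λ x → Δ² (G (toℕ k)) x (toℕ j)) (λ _ → refl) i)
                    (sumBelow-Δ²Gˣ (toℕ k) (suc (toℕ i)) (toℕ j))))
        (Δʸ-G-01 (toℕ k) (suc (toℕ i)) (toℕ<n i) j)
      rowPSums : ∀ i j → + 0 ℤ.≤ psumℤ (M k i) j
      rowPSums i j = subst (+ 0 ℤ.≤_)
        (sym (trans (psumℤ-sumBelow (Δ² (G (toℕ k)) (toℕ i)) (λ _ → refl) j)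
                    (trans (sumBelow-Δ²Gʸ (toℕ k) (toℕ i) (suc (toℕ j))) (Δˣ-G (toℕ k) (toℕ i) (suc (toℕ j))))))
        (increment-nonNeg (shifted (toℕ k) (toℕ i) (suc (toℕ j)))
          (subst (+ 0 ℤ.≤_) (psumℤ-sumBelow (Ŷ (toℕ i)) (Ŷ-toℕ i) j) (rowNonNeg i j)))

InP⇒InequalityDescription : ∀ {k n} (v : Fin k → Fin n) (λ′ : List ℕ) (X : Matrix ℚ (largest λ′) n) →
                            InP v λ′ X → InequalityDescription v λ′ X
InP⇒InequalityDescription v λ′ X (_ , c , Ms , Ms∈M , c≥0 , Σc≡1 , X≡cMs) =
  colPSumBounds , rowPSumNonNeg , rowSums , colSums
  where
  colPSum01 : ∀ t i j → Is01 (psumℤ (col (Ms t) j) i)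
  colPSum01 t with Ms∈M t
  ... | (_ , colPSums01 , _) , _ = colPSums01
  rowPSum≥0 : ∀ t i j → + 0 ℤ.≤ psumℤ (Ms t i) j
  rowPSum≥0 t with Ms∈M t
  ... | (_ , _ , rowPSums≥0) , _ = rowPSums≥0
  rowSum≡ : ∀ t i → sumℤ (Ms t i) ≡ + freq λ′ (largest λ′ ∸ toℕ i)
  rowSum≡ t with Ms∈M t
  ... | _ , rowSums≡ , _ = rowSums≡
  colSum≡ : ∀ t j → (j ∈v v → sumℤ (col (Ms t) j) ≡ + 1) × (¬ (j ∈v v) → sumℤ (col (Ms t) j) ≡ + 0)
  colSum≡ t with Ms∈M t
  ... | _ , _ , colSums≡ = colSums≡

  colPSum : ∀ i j → psumℚ (col X j) i ≡ weightedSum c (λ t → psumℤ (col (Ms t) j) i)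
  colPSum i j = maskedSum-weightedSum (λ i′ → toℕ i′ ≤ᵇ toℕ i) c (λ t i′ → Ms t i′ j) (λ i′ → X≡cMs i′ j)
  rowPSum : ∀ i j → psumℚ (X i) j ≡ weightedSum c (λ t → psumℤ (Ms t i) j)
  rowPSum i j = maskedSum-weightedSum (λ j′ → toℕ j′ ≤ᵇ toℕ j) c (λ t → Ms t i) (X≡cMs i)
  -- Under the mask λ _ → true a masked sum is definitionally the full sum.
  colSum : ∀ j → sumℚ (col X j) ≡ weightedSum c (λ t → sumℤ (col (Ms t) j))
  colSum j = maskedSum-weightedSum (λ _ → true) c (λ t i′ → Ms t i′ j) (λ i′ → X≡cMs i′ j)
  rowSum : ∀ i → sumℚ (X i) ≡ weightedSum c (λ t → sumℤ (Ms t i))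
  rowSum i = maskedSum-weightedSum (λ _ → true) c (λ t → Ms t i) (X≡cMs i)

  colPSumBounds : ∀ i j → (0ℚ ℚ.≤ psumℚ (col X j) i) × (psumℚ (col X j) i ℚ.≤ 1ℚ)
  colPSumBounds i j =
    subst (0ℚ ℚ.≤_) (sym (colPSum i j)) (weightedSum-≥ c≥0 Σc≡1 (λ t → Is01-nonNeg (colPSum01 t i j))) ,
    subst (ℚ._≤ 1ℚ) (sym (colPSum i j)) (weightedSum-≤ c≥0 Σc≡1 (λ t → Is01-≤1 (colPSum01 t i j)))
  rowPSumNonNeg : ∀ i j → 0ℚ ℚ.≤ psumℚ (X i) j
  rowPSumNonNeg i j = subst (0ℚ ℚ.≤_) (sym (rowPSum i j)) (weightedSum-≥ c≥0 Σc≡1 (λ t → rowPSum≥0 t i j))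
  rowSums : ∀ i → sumℚ (X i) ≡ toℚ (+ freq λ′ (largest λ′ ∸ toℕ i))
  rowSums i = trans (rowSum i) (weightedSum-const Σc≡1 (λ t → rowSum≡ t i))
  colSums : ∀ j → (j ∈v v → sumℚ (col X j) ≡ 1ℚ) × (¬ (j ∈v v) → sumℚ (col X j) ≡ 0ℚ)
  colSums j = (λ j∈v → trans (colSum j) (weightedSum-const Σc≡1 (λ t → proj₁ (colSum≡ t j) j∈v)))
            , (λ j∉v → trans (colSum j) (weightedSum-const Σc≡1 (λ t → proj₂ (colSum≡ t j) j∉v)))

scaledInequalities⇒InP : ∀ {k n} (v : Fin k → Fin n) (λ′ : List ℕ) (X : Matrix ℚ (largest λ′) n)
  (d : ℕ) (Y : Matrix ℤ (largest λ′) n) → (∀ i j → toℚ (Y i j) ≡ toℚ (+ suc d) ℚ.* X i j) →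
  InequalityDescription v λ′ X → InP v λ′ X
scaledInequalities⇒InP v λ′ X d Y Y≡DX (colPSumBounds , rowPSumNonNeg , rowSums , colSums) =
  suc d , (λ _ → 1/suc d) , M , M∈M , (λ _ → ℚP.nonNegative⁻¹ (1/suc d)) , sumℚ-1/suc d ,
  (λ i j → scaledSum⇒average d (λ k → M k i j) (trans (cong toℚ (sumℤ-M i j)) (Y≡DX i j)))
  where
  open Rounding d Y
  D = toℚ (+ suc d)
  colPSum : ∀ i j → toℚ (psumℤ (col Y j) i) ≡ D ℚ.* psumℚ (col X j) i
  colPSum i j = toℚ-maskedSum (λ i′ → toℕ i′ ≤ᵇ toℕ i) D (col Y j) (λ i′ → Y≡DX i′ j)
  rowPSum : ∀ i j → toℚ (psumℤ (Y i) j) ≡ D ℚ.* psumℚ (X i) j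
  rowPSum i j = toℚ-maskedSum (λ j′ → toℕ j′ ≤ᵇ toℕ j) D (Y i) (Y≡DX i)
  colSum : ∀ j → toℚ (sumℤ (col Y j)) ≡ D ℚ.* sumℚ (col X j)
  colSum j = toℚ-maskedSum (λ _ → true) D (col Y j) (λ i′ → Y≡DX i′ j)
  rowSum : ∀ i → toℚ (sumℤ (Y i)) ≡ D ℚ.* sumℚ (X i)
  rowSum i = toℚ-maskedSum (λ _ → true) D (Y i) (Y≡DX i)

  M∈M : ∀ k → InM v λ′ (M k)
  M∈M k =
    M-isSignMatrix
      (λ i j → scaled-nonNeg (suc d) (colPSum i j) (proj₁ (colPSumBounds i j)) ,
               scaled-≤ (suc d) (colPSum i j) (proj₂ (colPSumBounds i j)))
      (λ i j → scaled-nonNeg (suc d) (rowPSum i j) (rowPSumNonNeg i j)) k ,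
    (λ i → M-rowSum k i _ (scaled-≡ (suc d) (rowSum i) _ (rowSums i))) ,
    (λ j → (λ j∈v → M-colSum k j (+ 1) (scaled-≡ (suc d) (colSum j) (+ 1) (proj₁ (colSums j) j∈v)))
         , (λ j∉v → M-colSum k j (+ 0) (scaled-≡ (suc d) (colSum j) (+ 0) (proj₂ (colSums j) j∉v))))

InequalityDescription⇒InP : ∀ {k n} (v : Fin k → Fin n) (λ′ : List ℕ) (X : Matrix ℚ (largest λ′) n) →
                            InequalityDescription v λ′ X → InP v λ′ X
InequalityDescription⇒InP v λ′ X with commonDenominator-matrix X
... | d , clears = scaledInequalities⇒InP v λ′ X d (λ i j → proj₁ (clears i j)) (λ i j → proj₂ (clears i j))

theorem9p8 : (λ' : List ℕ) → IsPartition λ' → (n : ℕ) → 1 ≤ n →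
    (v : Fin (length λ') → Fin n) → StrictlyIncreasing v →
    (X : Matrix ℚ (largest λ') n) →
    ((InP v λ' X → InequalityDescription v λ' X) × (InequalityDescription v λ' X → InP v λ' X))
theorem9p8 λ' _ n _ v _ X = InP⇒InequalityDescription v λ' X , InequalityDescription⇒InP v λ' X
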